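{- Let $f:\mathbb{F}_2^n\to\{0,1\}$, let $\rho=\mathbb{E}_x[f(x)]$, and let $\epsilon>0$. Then: (a) $f$ is odd-cycle-free if and only if there exists $\alpha\in\mathbb{F}_2^n$ with $\hat f(\alpha)=-\rho$. (b) $f$ is $\epsilon$-far from odd-cycle-free if and only if $\hat f(\beta)\ge-\rho+2\epsilon$ for all $\beta\in\mathbb{F}_2^n$. (c) The distance of $f$ from odd-cycle-freeness is exactly $\frac12\left(\rho+\min_{\alpha\in\mathbb{F}_2^n}\hat f(\alpha)\right)$.
   Context: $\hat f(\alpha)=\mathbb{E}_{x\in\mathbb{F}_2^n}[f(x)(-1)^{\alpha\cdot x}]$ with $x$ uniform. A function $f:\mathbb{F}_2^n\to\{0,1\}$ is odd-cycle-free (OCF) if for every odd $k\ge1$ there are no $x_1,\ldots,x_k\in\mathbb{F}_2^n$ with $x_1+\cdots+x_k=0$ and $f(x_i)=1$ for all $i$. The distance of $f$ from OCF is $\min_{g\text{ OCF}}\Pr_x[f(x)\ne g(x)]$, and $f$ is $\epsilon$-far from OCF if this is at least $\epsilon$.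
   Formalization: The parameter ε in part (b) ranges over the positive rationals. -}

module Defs where

open import Data.Bool using (Bool; true; false; _xor_; _∧_; if_then_else_)
open import Data.Nat using (ℕ; zero; suc) renaming (_+_ to _+ℕ_)
open import Data.Vec using (Vec; []; _∷_; replicate; zipWith; foldr)
open import Data.Vec.Relation.Unary.All using (All)
open import Data.List using (List; []; _∷_; _++_; map)
import Data.List as L
open import Data.Rational using (ℚ; 0ℚ; 1ℚ; ½; -_; _+_; _*_; _≤_; _⊓_)
open import Data.Product using (Σ; _×_)
open import Relation.Binary.PropositionalEquality using (_≡_)
open import Relation.Nullary using (¬_)

-- The space F₂ⁿ : Bool vectors, with true = 1 ∈ F₂ and addition = xor.
F₂^ : ℕ → Set
F₂^ n = Vec Bool n

_⊕_ : {n : ℕ} → F₂^ n → F₂^ n → F₂^ n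
_⊕_ = zipWith _xor_

𝟎 : {n : ℕ} → F₂^ n
𝟎 = replicate _ false

vsum : {n k : ℕ} → Vec (F₂^ n) k → F₂^ n
vsum = foldr _ _⊕_ 𝟎

dot : {n : ℕ} → F₂^ n → F₂^ n → Bool
dot α x = foldr _ _xor_ false (zipWith _∧_ α x)

allVecs : (n : ℕ) → List (F₂^ n)
allVecs zero = [] ∷ []
allVecs (suc n) = map (false ∷_) (allVecs n) ++ map (true ∷_) (allVecs n)

inv2^ : ℕ → ℚ
inv2^ zero = 1ℚ
inv2^ (suc n) = ½ * inv2^ n

sumℚ : List ℚ → ℚ
sumℚ = L.foldr _+_ 0ℚ

𝔼 : (n : ℕ) → (F₂^ n → ℚ) → ℚ
𝔼 n h = inv2^ n * sumℚ (map h (allVecs n))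

toℚ : Bool → ℚ
toℚ b = if b then 1ℚ else 0ℚ

sign : Bool → ℚ
sign b = if b then - 1ℚ else 1ℚ

density : {n : ℕ} → (F₂^ n → Bool) → ℚ
density {n} f = 𝔼 n (λ x → toℚ (f x))

fourier : {n : ℕ} → (F₂^ n → Bool) → F₂^ n → ℚ
fourier {n} f α = 𝔼 n (λ x → toℚ (f x) * sign (dot α x))

minFourier : {n : ℕ} → (F₂^ n → Bool) → ℚ
minFourier {n} f = L.foldr _⊓_ (fourier f 𝟎) (map (fourier f) (allVecs n))

OCF : {n : ℕ} → (F₂^ n → Bool) → Set
OCF {n} f = (m : ℕ) → (xs : Vec (F₂^ n) (suc (m +ℕ m))) →
            vsum xs ≡ 𝟎 → ¬ All (λ x → f x ≡ true) xs

disagree : {n : ℕ} → (F₂^ n → Bool) → (F₂^ n → Bool) → ℚ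
disagree {n} f g = 𝔼 n (λ x → toℚ (f x xor g x))

-- d is the distance of f from OCF, i.e. d = min_{g OCF} Pr[f ≠ g]
-- (the minimum is attained and is a lower bound).
IsDistOCF : {n : ℕ} → (F₂^ n → Bool) → ℚ → Set
IsDistOCF {n} f d =
  Σ (F₂^ n → Bool) (λ g → OCF g × disagree f g ≡ d) ×
  ((g : F₂^ n → Bool) → OCF g → d ≤ disagree f g)

EpsFar : {n : ℕ} → (F₂^ n → Bool) → ℚ → Set
EpsFar {n} f ε = (g : F₂^ n → Bool) → OCF g → ε ≤ disagree f g

module Submission where

-- For α ∈ F₂ⁿ let f_α(x) = f(x) ∧ (α · x = 1).  A function supported in the hyperplane
-- α · x = 1 is odd-cycle-free, because α · (x₁ + ⋯ + x_k) ≡ k (mod 2).  Conversely, if g is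
-- odd-cycle-free then the affine system {α · x = 1 : g(x) = 1} is solvable: by Gaussian
-- elimination over F₂ it is either solvable or some sum of its equations reads 0 = 1, and
-- such a sum is an odd cycle of g.  Among the functions supported in α · x = 1 the closest
-- to f is f_α, at distance Pr[f(x) = 1, α · x = 0] = ½ (ρ + f̂(α)).  So the distance of f
-- from odd-cycle-freeness is min_α ½ (ρ + f̂(α)), and (a), (b) are the cases where this
-- is 0, respectively at least ε.

open import Defs
open import Algebra.Bundles using (CommutativeMonoid; CommutativeRing)
open import Data.Bool using (Bool; true; false; not; _∧_; _∨_; _xor_)
open import Data.Bool.Properties
  using (_≟_; ¬-not; xor-assoc; xor-same; xor-identityʳ; not-distribˡ-xor; not-involutive;
         ∧-distribˡ-xor; ∧-zeroʳ; ∧-identityʳ; ∨-zeroʳ; xor-∧-commutativeRing)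
open import Data.Empty using (⊥-elim)
open import Data.List using (List; []; _∷_; map; foldr; cartesianProduct)
open import Data.List.Membership.Propositional using (_∈_; lose)
open import Data.List.Membership.Propositional.Properties
  using (∈-map⁺; ∈-map⁻; ∈-++⁺ˡ; ∈-++⁺ʳ; ∈-cartesianProduct⁺; foldr-selective)
open import Data.List.Properties using (map-cong)
open import Data.List.Relation.Unary.Any using (here; there; any?; satisfied)
open import Data.Nat using (ℕ; zero; suc) renaming (_+_ to _+ℕ_)
open import Data.Nat.Properties using (+-suc)
open import Data.Product using (Σ; ∃; _×_; _,_; proj₁; proj₂)
open import Data.Rational
  using (ℚ; 0ℚ; 1ℚ; ½; -_; _+_; _*_; _≤_; _<_; _⊓_; Positive; positive)
open import Data.Rational.Properties
  using (≤-refl; ≤-reflexive; ≤-trans; <-irrefl; module ≤-Reasoning;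
         +-identityʳ; +-inverseʳ; +-mono-≤; +-monoʳ-≤; +-mono-<-≤; +-mono-≤-<; +-0-commutativeMonoid;
         *-identityʳ; *-zeroʳ; *-distribˡ-+; *-monoˡ-≤-nonNeg;
         positive⁻¹; nonNegative⁻¹; pos⇒nonNeg; pos*pos⇒pos; p⊓q≤p; p⊓q≤q; ⊓-sel)
open import Data.Rational.Solver using (module +-*-Solver)
open import Data.Sum using (_⊎_; inj₁; inj₂)
open import Data.Vec using (Vec; []; _∷_) renaming (_++_ to _++ᵥ_)
open import Data.Vec.Properties using (zipWith-assoc; zipWith-identityˡ; zipWith-identityʳ)
open import Data.Vec.Relation.Unary.All using (All; []; _∷_)
open import Data.Vec.Relation.Unary.All.Properties using (++⁺)
open import Function.Bundles using (_⇔_; mk⇔; Equivalence)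
open import Relation.Binary.PropositionalEquality
open import Relation.Nullary using (yes; no)

open import Algebra.Properties.CommutativeSemigroup
  (CommutativeRing.+-commutativeSemigroup xor-∧-commutativeRing)
  using () renaming (interchange to xor-interchange)
open import Algebra.Properties.CommutativeSemigroup
  (CommutativeMonoid.commutativeSemigroup +-0-commutativeMonoid)
  using () renaming (interchange to +-interchange)
open +-*-Solver using (solve; _:+_; _:*_; :-_; _:=_)
open Equivalence

private
  variable
    n : ℕ
    A : Set

-- The vector space F₂ⁿ

xor-cancelʳ : ∀ a b → (a xor b) xor b ≡ a
xor-cancelʳ a b = trans (xor-assoc a b b) (trans (cong (a xor_) (xor-same b)) (xor-identityʳ a))

⊕-assoc : (x y z : F₂^ n) → (x ⊕ y) ⊕ z ≡ x ⊕ (y ⊕ z)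
⊕-assoc = zipWith-assoc xor-assoc

⊕-identityˡ : (x : F₂^ n) → 𝟎 ⊕ x ≡ x
⊕-identityˡ = zipWith-identityˡ λ _ → refl

⊕-identityʳ : (x : F₂^ n) → x ⊕ 𝟎 ≡ x
⊕-identityʳ = zipWith-identityʳ xor-identityʳ

⊕-cancelʳ : (x y : F₂^ n) → (x ⊕ y) ⊕ y ≡ x
⊕-cancelʳ []      []      = refl
⊕-cancelʳ (a ∷ x) (b ∷ y) = cong₂ _∷_ (xor-cancelʳ a b) (⊕-cancelʳ x y)

dot-⊕ : (α x y : F₂^ n) → dot α (x ⊕ y) ≡ dot α x xor dot α y
dot-⊕ []      []      []       = refl
dot-⊕ (a ∷ α) (b ∷ x) (b′ ∷ y) = begin
  (a ∧ (b xor b′)) xor dot α (x ⊕ y)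
    ≡⟨ cong₂ _xor_ (∧-distribˡ-xor a b b′) (dot-⊕ α x y) ⟩
  ((a ∧ b) xor (a ∧ b′)) xor (dot α x xor dot α y)
    ≡⟨ xor-interchange (a ∧ b) (a ∧ b′) (dot α x) (dot α y) ⟩
  ((a ∧ b) xor dot α x) xor ((a ∧ b′) xor dot α y) ∎
  where open ≡-Reasoning

dot-𝟎 : (α : F₂^ n) → dot α 𝟎 ≡ false
dot-𝟎 []      = refl
dot-𝟎 (a ∷ α) = trans (cong (_xor dot α 𝟎) (∧-zeroʳ a)) (dot-𝟎 α)

vsum-++ : ∀ {k l} (xs : Vec (F₂^ n) k) (ys : Vec (F₂^ n) l) →
          vsum (xs ++ᵥ ys) ≡ vsum xs ⊕ vsum ys
vsum-++ []       ys = sym (⊕-identityˡ (vsum ys))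
vsum-++ (x ∷ xs) ys = trans (cong (x ⊕_) (vsum-++ xs ys)) (sym (⊕-assoc x (vsum xs) (vsum ys)))

∈-allVecs : (x : F₂^ n) → x ∈ allVecs n
∈-allVecs         []          = here refl
∈-allVecs {suc n} (false ∷ x) = ∈-++⁺ˡ (∈-map⁺ (false ∷_) (∈-allVecs x))
∈-allVecs {suc n} (true  ∷ x) =
  ∈-++⁺ʳ (map (false ∷_) (allVecs n)) (∈-map⁺ (true ∷_) (∈-allVecs x))

-- Affine systems over F₂

∈-bools : (b : Bool) → b ∈ true ∷ false ∷ []
∈-bools true  = here refl
∈-bools false = there (here refl)

search : {xs : List A} → (∀ x → x ∈ xs) →
         (q : A → Bool) → (∃ λ x → q x ≡ true) ⊎ (∀ x → q x ≡ false)
search {xs = xs} complete q with any? (λ x → q x ≟ true) xs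
... | yes found = inj₁ (satisfied found)
... | no  none  = inj₂ λ x → ¬-not λ qx → none (lose (complete x) qx)

-- A constraint (x , c) is the equation α · x = c in the unknown α.
Constraint : ℕ → Set
Constraint n = F₂^ n × Bool

System : ℕ → Set
System n = Constraint n → Bool

_⊞_ : Constraint n → Constraint n → Constraint n
(x , c) ⊞ (y , d) = x ⊕ y , c xor d

lift : Constraint n → Constraint (suc n)
lift (x , c) = false ∷ x , c

Satisfies : F₂^ n → Constraint n → Set
Satisfies α (x , c) = dot α x ≡ c

Solves : F₂^ n → System n → Set
Solves α P = ∀ e → P e ≡ true → Satisfies α e

Solvable : System n → Set
Solvable {n} P = Σ (F₂^ n) λ α → Solves α P

data Derivable (P : System n) : Constraint n → Set where
  given : ∀ {e} → P e ≡ true → Derivable P e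
  _⊞ᵈ_  : ∀ {e e′} → Derivable P e → Derivable P e′ → Derivable P (e ⊞ e′)

Inconsistent : System n → Set
Inconsistent P = Derivable P (𝟎 , true)

⊞-cancelʳ : (e e′ : Constraint n) → (e ⊞ e′) ⊞ e′ ≡ e
⊞-cancelʳ (x , c) (y , d) = cong₂ _,_ (⊕-cancelʳ x y) (xor-cancelʳ c d)

satisfies-⊞ : ∀ {α e e′} → Satisfies {n} α e → Satisfies α e′ → Satisfies α (e ⊞ e′)
satisfies-⊞ {α = α} {x , c} {y , d} αx αy = trans (dot-⊕ α x y) (cong₂ _xor_ αx αy)

satisfies-lift : ∀ a {α e} → Satisfies {n} α e → Satisfies (a ∷ α) (lift e)
satisfies-lift a {α} {x , c} αx = trans (cong (_xor dot α x) (∧-zeroʳ a)) αx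

derivable-lift : {P : System (suc n)} {Q : System n} →
                 (∀ e → Q e ≡ true → Derivable P (lift e)) →
                 ∀ {e} → Derivable Q e → Derivable P (lift e)
derivable-lift h (given q)  = h _ q
derivable-lift h (d ⊞ᵈ d′) = derivable-lift h d ⊞ᵈ derivable-lift h d′

module _ (P : System (suc n)) where

  eliminate-unused : (∀ x c → P (true ∷ x , c) ≡ false) →
                     Solvable (λ e → P (lift e)) ⊎ Inconsistent (λ e → P (lift e)) →
                     Solvable P ⊎ Inconsistent P
  eliminate-unused unused (inj₁ (α , sol)) = inj₁ (false ∷ α , sol′)
    where
    sol′ : Solves (false ∷ α) P
    sol′ (false ∷ x , c) p = sol (x , c) p
    sol′ (true  ∷ x , c) p with () ← trans (sym p) (unused x c)
  eliminate-unused unused (inj₂ bad) = inj₂ (derivable-lift (λ _ → given) bad)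

  module _ (p : F₂^ n) (c : Bool) where

    pivot : Constraint (suc n)
    pivot = true ∷ p , c

    -- Each constraint u of P with first coordinate 1 is lift e ⊞ pivot, where lift e = u ⊞ pivot.
    reduced : System n
    reduced e = P (lift e) ∨ P (lift e ⊞ pivot)

    eliminate-pivot : P pivot ≡ true →
                      Solvable reduced ⊎ Inconsistent reduced → Solvable P ⊎ Inconsistent P
    eliminate-pivot _ (inj₁ (α , sol)) = inj₁ (a ∷ α , sol′)
      where
      a = c xor dot α p

      satisfies-pivot : Satisfies (a ∷ α) pivot
      satisfies-pivot = trans (cong (_xor dot α p) (∧-identityʳ a)) (xor-cancelʳ c (dot α p))

      sol′ : Solves (a ∷ α) P
      sol′ (false ∷ x , d) q =
        satisfies-lift a {α} {x , d} (sol (x , d) (cong (_∨ P (lift (x , d) ⊞ pivot)) q))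
      sol′ u@(true ∷ x , d) q =
        subst (Satisfies (a ∷ α)) (⊞-cancelʳ u pivot)
          (satisfies-⊞ {α = a ∷ α} {lift e} {pivot}
            (satisfies-lift a {α} {e} (sol e reduced-e)) satisfies-pivot)
        where
        e = x ⊕ p , d xor c
        reduced-e : reduced e ≡ true
        reduced-e = trans (cong (P (lift e) ∨_) (trans (cong P (⊞-cancelʳ u pivot)) q)) (∨-zeroʳ _)
    eliminate-pivot P-pivot (inj₂ bad) = inj₂ (derivable-lift lifted bad)
      where
      lifted : ∀ e → reduced e ≡ true → Derivable P (lift e)
      lifted e q with P (lift e) in direct
      ... | true  = given direct
      ... | false = subst (Derivable P) (⊞-cancelʳ (lift e) pivot) (given q ⊞ᵈ given P-pivot)

∈-constraints : (e : Constraint n) → e ∈ cartesianProduct (allVecs n) (true ∷ false ∷ [])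
∈-constraints (x , c) = ∈-cartesianProduct⁺ (∈-allVecs x) (∈-bools c)

solvable⊎inconsistent : (P : System n) → Solvable P ⊎ Inconsistent P
solvable⊎inconsistent {zero} P with P ([] , true) in eq
... | true  = inj₂ (given eq)
... | false = inj₁ ([] , sol)
  where
  sol : Solves [] P
  sol ([] , false) _ = refl
  sol ([] , true)  p with () ← trans (sym p) eq
solvable⊎inconsistent {suc n} P with search ∈-constraints (λ (x , c) → P (true ∷ x , c))
... | inj₁ ((p , c) , P-pivot) =
  eliminate-pivot P p c P-pivot (solvable⊎inconsistent (reduced P p c))
... | inj₂ unused =
  eliminate-unused P (λ x c → unused (x , c)) (solvable⊎inconsistent (λ e → P (lift e)))

-- Odd-cycle-free functions are those supported in a hyperplane α · x = 1

isOdd : ℕ → Bool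
isOdd zero    = false
isOdd (suc k) = not (isOdd k)

isOdd-+ : ∀ k l → isOdd (k +ℕ l) ≡ isOdd k xor isOdd l
isOdd-+ zero    l = refl
isOdd-+ (suc k) l = trans (cong not (isOdd-+ k l)) (not-distribˡ-xor (isOdd k) (isOdd l))

isOdd-double : ∀ m → isOdd (m +ℕ m) ≡ false
isOdd-double m = trans (isOdd-+ m m) (xor-same (isOdd m))

isOdd⇒odd : ∀ k → isOdd k ≡ true → ∃ λ m → k ≡ suc (m +ℕ m)
isOdd⇒odd zero          ()
isOdd⇒odd (suc zero)    _   = 0 , refl
isOdd⇒odd (suc (suc k)) odd with isOdd⇒odd k (trans (sym (not-involutive (isOdd k))) odd)
... | m , refl = suc m , cong (λ j → suc (suc j)) (sym (+-suc m m))

SupportIn : F₂^ n → (F₂^ n → Bool) → Set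
SupportIn {n} α g = (x : F₂^ n) → g x ≡ true → dot α x ≡ true

∧≡true : ∀ {a b} → a ∧ b ≡ true → a ≡ true × b ≡ true
∧≡true {true} {true} _ = refl , refl

dot-vsum : ∀ α {g k} {xs : Vec (F₂^ n) k} → SupportIn α g → All (λ x → g x ≡ true) xs →
           dot α (vsum xs) ≡ isOdd k
dot-vsum α _ [] = dot-𝟎 α
dot-vsum α {xs = x ∷ xs} supp (gx ∷ gxs) =
  trans (dot-⊕ α x (vsum xs)) (cong₂ _xor_ (supp x gx) (dot-vsum α supp gxs))

SupportIn⇒OCF : (α : F₂^ n) (g : F₂^ n → Bool) → SupportIn α g → OCF g
SupportIn⇒OCF α g supp m xs sum≡𝟎 gxs
  with () ← trans (sym (trans (cong (dot α) sum≡𝟎) (dot-𝟎 α)))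
                  (trans (dot-vsum α supp gxs) (cong not (isOdd-double m)))

supportEquations : (F₂^ n → Bool) → System n
supportEquations g (x , c) = g x ∧ c

SupportSum : (F₂^ n → Bool) → F₂^ n → Bool → Set
SupportSum {n} g x c = ∃ λ k → Σ (Vec (F₂^ n) k) λ xs →
  All (λ y → g y ≡ true) xs × vsum xs ≡ x × isOdd k ≡ c

derivable⇒SupportSum : ∀ {g : F₂^ n → Bool} {e} → Derivable (supportEquations g) e →
                       SupportSum g (proj₁ e) (proj₂ e)
derivable⇒SupportSum {e = x , c} (given gx∧c) with ∧≡true {b = c} gx∧c
... | gx , refl = 1 , x ∷ [] , gx ∷ [] , ⊕-identityʳ x , refl
derivable⇒SupportSum (d ⊞ᵈ d′) with derivable⇒SupportSum d | derivable⇒SupportSum d′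
... | k , xs , gxs , refl , refl | l , ys , gys , refl , refl =
  k +ℕ l , xs ++ᵥ ys , ++⁺ gxs gys , vsum-++ xs ys , isOdd-+ k l

OCF⇒SupportIn : (g : F₂^ n → Bool) → OCF g → ∃ λ α → SupportIn α g
OCF⇒SupportIn g ocf with solvable⊎inconsistent (supportEquations g)
... | inj₁ (α , sol) = α , λ x gx → sol (x , true) (trans (∧-identityʳ (g x)) gx)
... | inj₂ bad with derivable⇒SupportSum bad
...   | k , xs , gxs , sum≡𝟎 , odd with isOdd⇒odd k odd
...     | m , refl = ⊥-elim (ocf m xs sum≡𝟎 gxs)

-- Expectations

sumℚ-map-+ : (u v : A → ℚ) (xs : List A) →
             sumℚ (map (λ x → u x + v x) xs) ≡ sumℚ (map u xs) + sumℚ (map v xs)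
sumℚ-map-+ u v []       = refl
sumℚ-map-+ u v (x ∷ xs) =
  trans (cong ((u x + v x) +_) (sumℚ-map-+ u v xs)) (+-interchange (u x) (v x) _ _)

sumℚ-map-mono : {u v : A → ℚ} → (∀ x → u x ≤ v x) → (xs : List A) →
                sumℚ (map u xs) ≤ sumℚ (map v xs)
sumℚ-map-mono u≤v []       = ≤-refl
sumℚ-map-mono u≤v (x ∷ xs) = +-mono-≤ (u≤v x) (sumℚ-map-mono u≤v xs)

sumℚ-map-0 : {u : A → ℚ} → (∀ x → u x ≡ 0ℚ) → (xs : List A) → sumℚ (map u xs) ≡ 0ℚ
sumℚ-map-0 u≡0 []       = refl
sumℚ-map-0 u≡0 (x ∷ xs) = cong₂ _+_ (u≡0 x) (sumℚ-map-0 u≡0 xs)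

sumℚ-map-nonNeg : {u : A → ℚ} → (∀ x → 0ℚ ≤ u x) → (xs : List A) → 0ℚ ≤ sumℚ (map u xs)
sumℚ-map-nonNeg u≥0 xs =
  ≤-trans (≤-reflexive (sym (sumℚ-map-0 {u = λ _ → 0ℚ} (λ _ → refl) xs))) (sumℚ-map-mono u≥0 xs)

sumℚ-map-pos : {u : A → ℚ} → (∀ x → 0ℚ ≤ u x) → ∀ {x xs} → x ∈ xs → 0ℚ < u x →
               0ℚ < sumℚ (map u xs)
sumℚ-map-pos u≥0 {xs = _ ∷ xs} (here refl)  ux>0 =
  +-mono-<-≤ ux>0 (sumℚ-map-nonNeg u≥0 xs)
sumℚ-map-pos u≥0 {xs = y ∷ _}  (there x∈xs) ux>0 =
  +-mono-≤-< (u≥0 y) (sumℚ-map-pos u≥0 x∈xs ux>0)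

inv2^-positive : ∀ n → Positive (inv2^ n)
inv2^-positive zero    = _
inv2^-positive (suc n) = pos*pos⇒pos ½ (inv2^ n) {{inv2^-positive n}}

𝔼-+ : (u v : F₂^ n → ℚ) → 𝔼 n (λ x → u x + v x) ≡ 𝔼 n u + 𝔼 n v
𝔼-+ {n} u v = trans (cong (inv2^ n *_) (sumℚ-map-+ u v (allVecs n))) (*-distribˡ-+ (inv2^ n) _ _)

module _ {u v : F₂^ n → ℚ} where

  𝔼-cong : (∀ x → u x ≡ v x) → 𝔼 n u ≡ 𝔼 n v
  𝔼-cong u≡v = cong (λ s → inv2^ n * sumℚ s) (map-cong u≡v (allVecs n))

  𝔼-mono : (∀ x → u x ≤ v x) → 𝔼 n u ≤ 𝔼 n v
  𝔼-mono u≤v = *-monoˡ-≤-nonNeg (inv2^ n) {{pos⇒nonNeg (inv2^ n) {{inv2^-positive n}}}}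
                 (sumℚ-map-mono u≤v (allVecs n))

toℚ-mono : ∀ {a b} → (a ≡ true → b ≡ true) → toℚ a ≤ toℚ b
toℚ-mono {true}          a⇒b with refl ← a⇒b refl = ≤-refl
toℚ-mono {false} {true}  _   = nonNegative⁻¹ 1ℚ
toℚ-mono {false} {false} _   = ≤-refl

𝔼-indicator≡0⇔ : (b : F₂^ n → Bool) →
                 𝔼 n (λ x → toℚ (b x)) ≡ 0ℚ ⇔ (∀ x → b x ≡ false)
𝔼-indicator≡0⇔ {n} b = mk⇔ vanishes 𝔼≡0
  where
  𝔼≡0 : (∀ x → b x ≡ false) → 𝔼 n (λ x → toℚ (b x)) ≡ 0ℚ
  𝔼≡0 b≡false = trans (cong (inv2^ n *_) (sumℚ-map-0 (λ x → cong toℚ (b≡false x)) (allVecs n)))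
                      (*-zeroʳ (inv2^ n))

  vanishes : 𝔼 n (λ x → toℚ (b x)) ≡ 0ℚ → ∀ x → b x ≡ false
  vanishes 𝔼≡0 x with b x in bx
  ... | false = refl
  ... | true  = ⊥-elim (<-irrefl (sym 𝔼≡0)
                  (positive⁻¹ _ {{pos*pos⇒pos (inv2^ n) {{inv2^-positive n}} _ {{positive sum>0}}}}))
    where
    sum>0 : 0ℚ < sumℚ (map (λ x → toℚ (b x)) (allVecs n))
    sum>0 = sumℚ-map-pos (λ y → toℚ-mono {false} λ ())
              (∈-allVecs x) (subst (λ c → 0ℚ < toℚ c) (sym bx) (positive⁻¹ 1ℚ))

-- Rational arithmetic

½*p+½*p≡p : ∀ p → ½ * p + ½ * p ≡ p
½*p+½*p≡p p = trans (solve 2 (λ h p → h :* p :+ h :* p := p :* (h :+ h)) refl ½ p) (*-identityʳ p)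

½*[p+p]≡p : ∀ p → ½ * (p + p) ≡ p
½*[p+p]≡p p = trans (*-distribˡ-+ ½ p p) (½*p+½*p≡p p)

-p+[p+q]≡q : ∀ p q → - p + (p + q) ≡ q
-p+[p+q]≡q p q = solve 2 (λ p q → :- p :+ (p :+ q) := q) refl p q

p+[-p+q]≡q : ∀ p q → p + (- p + q) ≡ q
p+[-p+q]≡q p q = solve 2 (λ p q → p :+ (:- p :+ q) := q) refl p q

-p+[½*[p+q]+½*[p+q]]≡q : ∀ p q → - p + (½ * (p + q) + ½ * (p + q)) ≡ q
-p+[½*[p+q]+½*[p+q]]≡q p q = trans (cong (- p +_) (½*p+½*p≡p (p + q))) (-p+[p+q]≡q p q)

½*[p+q]≡0⇔q≡-p : ∀ p q → ½ * (p + q) ≡ 0ℚ ⇔ q ≡ - p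
½*[p+q]≡0⇔q≡-p p q = mk⇔ to′ from′
  where
  to′ : ½ * (p + q) ≡ 0ℚ → q ≡ - p
  to′ h = begin
    q                                    ≡⟨ sym (-p+[½*[p+q]+½*[p+q]]≡q p q) ⟩
    - p + (½ * (p + q) + ½ * (p + q))    ≡⟨ cong (λ r → - p + (r + r)) h ⟩
    - p + 0ℚ                             ≡⟨ +-identityʳ (- p) ⟩
    - p                                  ∎
    where open ≡-Reasoning
  from′ : q ≡ - p → ½ * (p + q) ≡ 0ℚ
  from′ refl = trans (cong (½ *_) (+-inverseʳ p)) (*-zeroʳ ½)

r≤½*[p+q]⇔-p+[r+r]≤q : ∀ p q r → r ≤ ½ * (p + q) ⇔ - p + (r + r) ≤ q
r≤½*[p+q]⇔-p+[r+r]≤q p q r = mk⇔ to′ from′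
  where
  to′ : r ≤ ½ * (p + q) → - p + (r + r) ≤ q
  to′ h = ≤-trans (+-monoʳ-≤ (- p) (+-mono-≤ h h)) (≤-reflexive (-p+[½*[p+q]+½*[p+q]]≡q p q))
  from′ : - p + (r + r) ≤ q → r ≤ ½ * (p + q)
  from′ h = begin
    r                          ≡⟨ sym (½*[p+p]≡p r) ⟩
    ½ * (r + r)                ≡⟨ cong (½ *_) (sym (p+[-p+q]≡q p (r + r))) ⟩
    ½ * (p + (- p + (r + r)))  ≤⟨ *-monoˡ-≤-nonNeg ½ (+-monoʳ-≤ p h) ⟩
    ½ * (p + q)                ∎
    where open ≤-Reasoning

-- Distance from odd-cycle-freeness

foldr-⊓-≤ : (h : A → ℚ) (z : ℚ) {x : A} {xs : List A} → x ∈ xs → foldr _⊓_ z (map h xs) ≤ h x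
foldr-⊓-≤ h z {xs = y ∷ _}  (here refl)  = p⊓q≤p (h y) _
foldr-⊓-≤ h z {xs = y ∷ _}  (there x∈xs) = ≤-trans (p⊓q≤q (h y) _) (foldr-⊓-≤ h z x∈xs)

module _ (f : F₂^ n → Bool) where

  minFourier-≤ : ∀ α → minFourier f ≤ fourier f α
  minFourier-≤ α = foldr-⊓-≤ (fourier f) (fourier f 𝟎) (∈-allVecs α)

  minFourier-attained : ∃ λ α → minFourier f ≡ fourier f α
  minFourier-attained with foldr-selective ⊓-sel (fourier f 𝟎) (map (fourier f) (allVecs n))
  ... | inj₁ min≡ = 𝟎 , min≡
  ... | inj₂ min∈ with ∈-map⁻ (fourier f) min∈
  ...   | α , _ , min≡ = α , min≡

restrict : F₂^ n → (F₂^ n → Bool) → F₂^ n → Bool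
restrict α f x = f x ∧ dot α x

OCF-restrict : (α : F₂^ n) (f : F₂^ n → Bool) → OCF (restrict α f)
OCF-restrict α f = SupportIn⇒OCF α (restrict α f) λ x fx∧αx → proj₂ (∧≡true fx∧αx)

module _ (f : F₂^ n → Bool) (α : F₂^ n) where

  disagree-restrict : disagree f (restrict α f) ≡ ½ * (density f + fourier f α)
  disagree-restrict = sym (begin
    ½ * (𝔼 n fℚ + 𝔼 n fχ)                ≡⟨ cong (½ *_) (sym (𝔼-+ fℚ fχ)) ⟩
    ½ * 𝔼 n (λ x → fℚ x + fχ x)          ≡⟨ cong (½ *_) (𝔼-cong λ x → pointwise (f x) (dot α x)) ⟩
    ½ * 𝔼 n (λ x → missed x + missed x)  ≡⟨ cong (½ *_) (𝔼-+ missed missed) ⟩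
    ½ * (𝔼 n missed + 𝔼 n missed)        ≡⟨ ½*[p+p]≡p (𝔼 n missed) ⟩
    𝔼 n missed                           ∎)
    where
    open ≡-Reasoning
    fℚ fχ missed : F₂^ n → ℚ
    fℚ x = toℚ (f x)
    fχ x = toℚ (f x) * sign (dot α x)
    missed x = toℚ (f x xor restrict α f x)
    pointwise : ∀ a d → toℚ a + toℚ a * sign d ≡ toℚ (a xor (a ∧ d)) + toℚ (a xor (a ∧ d))
    pointwise true  true  = refl
    pointwise true  false = refl
    pointwise false true  = refl
    pointwise false false = refl

  restrict-closest : ∀ {g} → SupportIn α g → disagree f (restrict α f) ≤ disagree f g
  restrict-closest {g} supp = 𝔼-mono λ x → toℚ-mono (closer (f x) (dot α x) (g x) (supp x))
    where
    closer : ∀ a d b → (b ≡ true → d ≡ true) → a xor (a ∧ d) ≡ true → a xor b ≡ true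
    closer true false false _ _ = refl
    closer true false true  b⇒d _ with () ← b⇒d refl

  disagree-restrict≡0⇔ : disagree f (restrict α f) ≡ 0ℚ ⇔ SupportIn α f
  disagree-restrict≡0⇔ = mk⇔
    (λ 𝔼≡0 x → to (missed≡false⇔ (f x) (dot α x)) (to (𝔼-indicator≡0⇔ _) 𝔼≡0 x))
    (λ supp → from (𝔼-indicator≡0⇔ _) λ x → from (missed≡false⇔ (f x) (dot α x)) (supp x))
    where
    missed≡false⇔ : ∀ a d → a xor (a ∧ d) ≡ false ⇔ (a ≡ true → d ≡ true)
    missed≡false⇔ true  true  = mk⇔ (λ _ _ → refl) (λ _ → refl)
    missed≡false⇔ true  false = mk⇔ (λ ()) (λ a⇒d → sym (a⇒d refl))
    missed≡false⇔ false d     = mk⇔ (λ _ ()) (λ _ → refl)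

module _ (f : F₂^ n → Bool) where

  OCF⇒fourier-bound : ∀ {g} → OCF g → ∃ λ α → ½ * (density f + fourier f α) ≤ disagree f g
  OCF⇒fourier-bound {g} ocf = let α , supp = OCF⇒SupportIn g ocf in
    α , ≤-trans (≤-reflexive (sym (disagree-restrict f α))) (restrict-closest f α supp)

  OCF⇔fourier≡-density : OCF f ⇔ Σ (F₂^ n) (λ α → fourier f α ≡ - density f)
  OCF⇔fourier≡-density = mk⇔
    (λ ocf → let α , supp = OCF⇒SupportIn f ocf in
      α , to (distance≡0⇔ α) (from (disagree-restrict≡0⇔ f α) supp))
    (λ (α , f̂α≡-ρ) →
      SupportIn⇒OCF α f (to (disagree-restrict≡0⇔ f α) (from (distance≡0⇔ α) f̂α≡-ρ)))
    where
    distance≡0⇔ : ∀ α → disagree f (restrict α f) ≡ 0ℚ ⇔ fourier f α ≡ - density f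
    distance≡0⇔ α = subst (λ d → d ≡ 0ℚ ⇔ fourier f α ≡ - density f) (sym (disagree-restrict f α))
                          (½*[p+q]≡0⇔q≡-p (density f) (fourier f α))

  EpsFar⇔fourier≥ : ∀ ε → EpsFar f ε ⇔ (∀ β → - density f + (ε + ε) ≤ fourier f β)
  EpsFar⇔fourier≥ ε = mk⇔
    (λ far β → to (r≤½*[p+q]⇔-p+[r+r]≤q (density f) (fourier f β) ε)
      (≤-trans (far (restrict β f) (OCF-restrict β f)) (≤-reflexive (disagree-restrict f β))))
    (λ bound g ocf → let α , gap≤ = OCF⇒fourier-bound ocf in
      ≤-trans (from (r≤½*[p+q]⇔-p+[r+r]≤q (density f) (fourier f α) ε) (bound α)) gap≤)

  distOCF : IsDistOCF f (½ * (density f + minFourier f))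
  distOCF = attained , lowerBound
    where
    attained : Σ (F₂^ n → Bool) λ g → OCF g × disagree f g ≡ ½ * (density f + minFourier f)
    attained = let α , min≡ = minFourier-attained f in
      restrict α f , OCF-restrict α f ,
      trans (disagree-restrict f α) (cong (λ m → ½ * (density f + m)) (sym min≡))

    lowerBound : ∀ g → OCF g → ½ * (density f + minFourier f) ≤ disagree f g
    lowerBound g ocf = let α , gap≤ = OCF⇒fourier-bound ocf in
      ≤-trans (*-monoˡ-≤-nonNeg ½ (+-monoʳ-≤ (density f) (minFourier-≤ f α))) gap≤

lemma2p2 : (n : ℕ) (f : F₂^ n → Bool) →
    (OCF f ⇔ Σ (F₂^ n) (λ α → fourier f α ≡ - density f)) ×
    ((ε : ℚ) → 0ℚ < ε →
      (EpsFar f ε ⇔ ((β : F₂^ n) → (- density f) + (ε + ε) ≤ fourier f β))) ×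
    IsDistOCF f (½ * (density f + minFourier f))
-- Part (b) holds for every ε.
lemma2p2 n f = OCF⇔fourier≡-density f , (λ ε _ → EpsFar⇔fourier≥ f ε) , distOCF f
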